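{- Let $n\ge 2$ and let $h$ be a Hamiltonian cycle of $Q_n$ with chromatic vector $c(h)=(c_0,\ldots,c_{n-1})$. If $c_i>\alpha_=(Q_{n-1})$ for some $i$, then $h$ contains a square whose rims are $i$-th dimension edges; that is, there are two edges of $h$, both $i$-th dimension edges, which are opposite edges of a 4-cycle of $Q_n$.
   Context: $Q_m$ is the hypercube on $\{0,1\}^m$, vertices adjacent iff they differ in exactly one coordinate; it is bipartite with classes given by the parity of the number of $1$'s. For a bipartite graph $G$ with bipartition classes $V_0,V_1$, the equi-independence number $\alpha_=(G)$ is the maximum cardinality of an independent set $I$ of $G$ with $|I\cap V_0|=|I\cap V_1|$. An $i$-th dimension edge of $Q_n$ (coordinates indexed $0,\ldots,n-1$) is an edge whose endpoints differ in coordinate $i$. For a Hamiltonian cycle $h=h_0\cdots h_{2^n-1}$ (indices mod $2^n$), $c_i$ is the number of edges $\{h_\iota,h_{\iota+1}\}$ of $h$ that are $i$-th dimension edges. A square inscribed in $h$ is a 4-cycle $v_0v_1v_2v_3$ of $Q_n$ such that for some indices $a,b$, $h_ah_{a+1}h_bh_{b+1}$ equals $v_0v_1v_2v_3$ or $v_0v_1v_3v_2$; its rims are $\{v_0,v_1\}$ and $\{v_2,v_3\}$. -}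

module Defs where

open import Data.Nat using (ℕ; zero; suc; _+_; _<_; _≤_; _<?_; _^_)
open import Data.Bool using (Bool; true; false; not; _xor_)
open import Data.Fin using (Fin; toℕ; fromℕ<) renaming (zero to fzero)
open import Data.Vec using (Vec; lookup) renaming ([] to []ᵥ; _∷_ to _∷ᵥ_)
open import Data.List using (List; []; _∷_; length; allFin)
open import Data.List.Relation.Unary.Unique.Propositional using (Unique)
open import Data.List.Membership.Propositional using (_∈_)
open import Data.Product using (Σ; ∃; _×_)
open import Relation.Nullary using (¬_; yes; no)
open import Relation.Nullary.Decidable using (⌊_⌋)
open import Relation.Binary.PropositionalEquality using (_≡_; _≢_)
import Data.Bool.Properties as BoolP

Vertex : ℕ → Set
Vertex m = Vec Bool m

DimEdge : ∀ {m} → Fin m → Vertex m → Vertex m → Set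
DimEdge {m} i u v = (lookup u i ≢ lookup v i) × (∀ (j : Fin m) → j ≢ i → lookup u j ≡ lookup v j)

Adjacent : ∀ {m} → Vertex m → Vertex m → Set
Adjacent {m} u v = ∃ λ (i : Fin m) → DimEdge i u v

-- Parity of the number of 1's (true = odd); class V_0 = even, V_1 = odd.
parity : ∀ {m} → Vertex m → Bool
parity []ᵥ = false
parity (b ∷ᵥ v) = b xor parity v

countB : ∀ {A : Set} → (A → Bool) → List A → ℕ
countB p [] = 0
countB p (x ∷ xs) with p x
... | true = suc (countB p xs)
... | false = countB p xs

IsIndependent : ∀ {m} → List (Vertex m) → Set
IsIndependent I = Unique I × (∀ {u v} → u ∈ I → v ∈ I → ¬ Adjacent u v)

IsEquiIndependent : ∀ {m} → List (Vertex m) → Set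
IsEquiIndependent I =
  IsIndependent I × (countB (λ v → not (parity v)) I ≡ countB parity I)

IsEquiIndependenceNumber : ℕ → ℕ → Set
IsEquiIndependenceNumber m a =
  (Σ (List (Vertex m)) λ I → IsEquiIndependent I × length I ≡ a)
  × (∀ (I : List (Vertex m)) → IsEquiIndependent I → length I ≤ a)

next : ∀ {N} → Fin N → Fin N
next {suc k} i with suc (toℕ i) <? suc k
... | yes p = fromℕ< p
... | no _ = fzero

record HamiltonianCycle (n : ℕ) : Set where
  field
    h        : Fin (2 ^ n) → Vertex n
    distinct : ∀ (a b : Fin (2 ^ n)) → h a ≡ h b → a ≡ b
    adjacent : ∀ (a : Fin (2 ^ n)) → Adjacent (h a) (h (next a))
open HamiltonianCycle public

-- c_i(h): number of edges {h_ι, h_{ι+1}} of h that are i-th dimension edges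
-- (consecutive vertices are adjacent, so this is: they differ in coordinate i).
chromatic : ∀ {n} → HamiltonianCycle n → Fin n → ℕ
chromatic H i =
  countB (λ ι → not ⌊ BoolP._≟_ (lookup (h H ι) i) (lookup (h H (next ι)) i) ⌋) (allFin _)

IsFourCycle : ∀ {m} → Vertex m → Vertex m → Vertex m → Vertex m → Set
IsFourCycle v0 v1 v2 v3 =
  (v0 ≢ v1) × (v0 ≢ v2) × (v0 ≢ v3) × (v1 ≢ v2) × (v1 ≢ v3) × (v2 ≢ v3)
  × Adjacent v0 v1 × Adjacent v1 v2 × Adjacent v2 v3 × Adjacent v3 v0

-- Deleting coordinate i maps the start of each i-th dimension edge of h to its "shadow" in
-- Q_{n-1}. Two i-edges with the same shadow would be one edge traversed in both directions,
-- which is impossible in a cycle of length 2^n ≥ 4; two i-edges with adjacent shadows are the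
-- rims of an inscribed square. The parity of the shadow of h_ι is kept along i-steps of the
-- cycle and flips along all other steps; since it is balanced over all vertices, it is also
-- balanced over the starts of the i-steps. So without an inscribed square the shadows form an
-- equi-independent set of Q_{n-1} of size c_i, contradicting c_i > α_=(Q_{n-1}).

module Submission where

open import Defs
open import Data.Nat using (ℕ; zero; suc; _+_; _≤_; _<_; _<?_; _∸_; z≤n; s≤s; _^_)
import Data.Nat.Properties as ℕ
open import Data.Bool using (Bool; true; false; not; _∧_; _xor_)
import Data.Bool.Properties as Bool
open import Data.Bool.Properties
  using (not-involutive; not-¬; ¬-not; xor-assoc; xor-comm; xor-same; xor-identityʳ;
         not-distribˡ-xor; not-distribʳ-xor)
open import Data.List using (List; []; _∷_; length; map; filter; _++_; allFin)
open import Data.List.Properties using (length-map; length-++; length-tabulate)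
open import Data.List.Membership.Propositional using (_∈_)
open import Data.List.Membership.Propositional.Properties
  using (∈-∃++; ∈-++⁺ˡ; ∈-++⁺ʳ; ∈-map⁺; ∈-map⁻; ∈-filter⁻; ∈-allFin)
open import Data.List.Relation.Unary.Any using (here; there)
open import Data.List.Relation.Unary.All as All using (All; []; _∷_)
import Data.List.Relation.Unary.All.Properties as AllProp
open import Data.List.Relation.Unary.AllPairs using ([]; _∷_)
open import Data.List.Relation.Unary.Unique.Propositional using (Unique)
import Data.List.Relation.Unary.Unique.Propositional.Properties as UniqueProp
open import Data.List.Relation.Binary.Subset.Propositional using (_⊆_)
open import Data.List.Relation.Binary.Permutation.Propositional
  using (_↭_; ↭-sym; ↭-trans; refl; prep; swap; trans)
open import Data.List.Relation.Binary.Permutation.Propositional.Properties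
  using (∈-resp-↭; ↭-length; shift)
open import Data.Product using (Σ; ∃; ∃₂; _×_; _,_; proj₁; proj₂)
open import Data.Sum using (_⊎_; inj₁; inj₂)
open import Data.Empty using (⊥; ⊥-elim)
open import Data.Fin using (Fin; toℕ; punchIn; punchOut) renaming (zero to fzero; suc to fsuc)
open import Data.Fin.Properties
  using (toℕ-injective; toℕ-fromℕ<; toℕ<n; _≟_; all?; any?; punchInᵢ≢i; punchOut-punchIn; punchIn-punchOut)
open import Data.Vec using (lookup; tabulate; updateAt; removeAt; insertAt)
  renaming ([] to []ᵥ; _∷_ to _∷ᵥ_)
open import Data.Vec.Properties
  using (tabulate∘lookup; tabulate-cong; updateAt-updateAt; updateAt-cong; updateAt-id;
         updateAt-commutes; lookup∘updateAt; lookup∘updateAt′; removeAt-punchOut; insertAt-removeAt; ≡-dec)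
open import Function using (_∘_; id)
open import Relation.Nullary using (¬_; Dec; yes; no; does; ¬?; _×-dec_; _→-dec_; _⊎-dec_)
open import Relation.Nullary.Decidable using (¬¬-excluded-middle; isYes≗does; decidable-stable)
open import Relation.Unary using (Decidable)
open import Relation.Binary.PropositionalEquality
  using (_≡_; _≢_; refl; sym; cong; cong₂; subst; module ≡-Reasoning)
  renaming (trans to ≡-trans)

private variable
  A B : Set

-- Counting and permutations

countB-map : (p : B → Bool) (f : A → B) (xs : List A) → countB p (map f xs) ≡ countB (λ x → p (f x)) xs
countB-map p f []       = refl
countB-map p f (x ∷ xs) with p (f x)
... | true  = cong suc (countB-map p f xs)
... | false = countB-map p f xs

countB-cong : {p q : A → Bool} → (∀ x → p x ≡ q x) → (xs : List A) → countB p xs ≡ countB q xs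
countB-cong {p = p} {q} p≗q []       = refl
countB-cong {p = p} {q} p≗q (x ∷ xs) with p x | q x | p≗q x
... | true  | true  | _ = cong suc (countB-cong p≗q xs)
... | false | false | _ = countB-cong p≗q xs

countB-∷ : (p : A → Bool) (x : A) (xs : List A) → countB p (x ∷ xs) ≡ countB p (x ∷ []) + countB p xs
countB-∷ p x xs with p x
... | true  = refl
... | false = refl

countB-↭ : (p : A → Bool) {xs ys : List A} → xs ↭ ys → countB p xs ≡ countB p ys
countB-↭ p refl = refl
countB-↭ p (prep x xs↭ys) with p x
... | true  = cong suc (countB-↭ p xs↭ys)
... | false = countB-↭ p xs↭ys
countB-↭ p {x ∷ y ∷ xs} {y ∷ x ∷ ys} (swap x y xs↭ys) = begin
  countB p (x ∷ y ∷ xs)              ≡⟨ countB-∷ p x (y ∷ xs) ⟩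
  [x] + countB p (y ∷ xs)            ≡⟨ cong ([x] +_) (countB-∷ p y xs) ⟩
  [x] + ([y] + countB p xs)          ≡⟨ cong (λ k → [x] + ([y] + k)) (countB-↭ p xs↭ys) ⟩
  [x] + ([y] + countB p ys)          ≡⟨ ℕ.+-assoc [x] [y] _ ⟨
  [x] + [y] + countB p ys            ≡⟨ cong (_+ countB p ys) (ℕ.+-comm [x] [y]) ⟩
  [y] + [x] + countB p ys            ≡⟨ ℕ.+-assoc [y] [x] _ ⟩
  [y] + ([x] + countB p ys)          ≡⟨ cong ([y] +_) (countB-∷ p x ys) ⟨
  [y] + countB p (x ∷ ys)            ≡⟨ countB-∷ p y (x ∷ ys) ⟨
  countB p (y ∷ x ∷ ys)              ∎
  where
  open ≡-Reasoning
  [x] [y] : ℕ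
  [x] = countB p (x ∷ [])
  [y] = countB p (y ∷ [])
countB-↭ p (trans xs↭ys ys↭zs) = ≡-trans (countB-↭ p xs↭ys) (countB-↭ p ys↭zs)

countB-partition : (e p : A → Bool) (xs : List A)
  → countB p xs ≡ countB (λ x → e x ∧ p x) xs + countB (λ x → not (e x) ∧ p x) xs
countB-partition e p []       = refl
countB-partition e p (x ∷ xs) with e x | p x
... | true  | true  = cong suc (countB-partition e p xs)
... | true  | false = countB-partition e p xs
... | false | true  = ≡-trans (cong suc (countB-partition e p xs)) (sym (ℕ.+-suc _ _))
... | false | false = countB-partition e p xs

module _ {P : A → Set} (P? : Decidable P) where

  length-filter : (xs : List A) → length (filter P? xs) ≡ countB (λ x → does (P? x)) xs
  length-filter []       = refl
  length-filter (x ∷ xs) with does (P? x)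
  ... | true  = cong suc (length-filter xs)
  ... | false = length-filter xs

  countB-filter : (p : A → Bool) (xs : List A)
    → countB p (filter P? xs) ≡ countB (λ x → does (P? x) ∧ p x) xs
  countB-filter p []       = refl
  countB-filter p (x ∷ xs) with does (P? x)
  ... | false = countB-filter p xs
  ... | true with p x
  ...   | true  = cong suc (countB-filter p xs)
  ...   | false = countB-filter p xs

marked-balanced : (σ : A → A) {xs : List A} → map σ xs ↭ xs → (e f : A → Bool)
  → (∀ x → f (σ x) ≡ f x xor not (e x)) → countB f xs ≡ countB (not ∘ f) xs
  → countB (λ x → e x ∧ f x) xs ≡ countB (λ x → e x ∧ not (f x)) xs
marked-balanced σ {xs} σ-permutes e f σ-step f-balanced =
  ℕ.+-cancelʳ-≡ #¬e∧f #e∧f #e∧¬f (begin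
    #e∧f + #¬e∧f          ≡⟨ countB-partition e f xs ⟨
    countB f xs           ≡⟨ f-balanced ⟩
    countB (not ∘ f) xs   ≡⟨ countB-partition e (not ∘ f) xs ⟩
    #e∧¬f + #¬e∧¬f        ≡⟨ cong (#e∧¬f +_) #¬e∧¬f≡#¬e∧f ⟩
    #e∧¬f + #¬e∧f         ∎)
  where
  open ≡-Reasoning
  #e∧f #e∧¬f #¬e∧f #¬e∧¬f : ℕ
  #e∧f   = countB (λ x → e x ∧ f x) xs
  #e∧¬f  = countB (λ x → e x ∧ not (f x)) xs
  #¬e∧f  = countB (λ x → not (e x) ∧ f x) xs
  #¬e∧¬f = countB (λ x → not (e x) ∧ not (f x)) xs
  on-marked : ∀ x → e x ∧ f (σ x) ≡ e x ∧ f x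
  on-marked x rewrite σ-step x with e x
  ... | true  = xor-identityʳ (f x)
  ... | false = refl
  on-unmarked : ∀ x → not (e x) ∧ f (σ x) ≡ not (e x) ∧ not (f x)
  on-unmarked x rewrite σ-step x with e x
  ... | true  = refl
  ... | false = xor-comm (f x) true
  #¬e∧¬f≡#¬e∧f : #¬e∧¬f ≡ #¬e∧f
  #¬e∧¬f≡#¬e∧f = ℕ.+-cancelˡ-≡ #e∧f #¬e∧¬f #¬e∧f (begin
    #e∧f + #¬e∧¬f         ≡⟨ cong₂ _+_ (countB-cong on-marked xs) (countB-cong on-unmarked xs) ⟨
    countB (λ x → e x ∧ f (σ x)) xs + countB (λ x → not (e x) ∧ f (σ x)) xs
                          ≡⟨ countB-partition e (f ∘ σ) xs ⟨
    countB (f ∘ σ) xs     ≡⟨ countB-map f σ xs ⟨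
    countB f (map σ xs)   ≡⟨ countB-↭ f σ-permutes ⟩
    countB f xs           ≡⟨ countB-partition e f xs ⟩
    #e∧f + #¬e∧f          ∎)

private
  ⊆-remove : {x : A} {xs ys : List A} → Unique (x ∷ xs) → (x ∷ xs) ⊆ ys
    → ∃ λ ys′ → ys ↭ x ∷ ys′ × xs ⊆ ys′
  ⊆-remove {x = x} (x∉xs ∷ _) x∷xs⊆ys with ∈-∃++ (x∷xs⊆ys (here refl))
  ... | as , bs , refl = as ++ bs , shift x as bs , xs⊆as++bs
    where
    xs⊆as++bs : _ ⊆ as ++ bs
    xs⊆as++bs y∈xs with ∈-resp-↭ (shift x as bs) (x∷xs⊆ys (there y∈xs))
    ... | here x≡y = ⊥-elim (All.lookup x∉xs y∈xs (sym x≡y))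
    ... | there y∈as++bs = y∈as++bs

Unique⇒length≤ : {xs ys : List A} → Unique xs → xs ⊆ ys → length xs ≤ length ys
Unique⇒length≤ {xs = []}     _         _     = z≤n
Unique⇒length≤ {xs = x ∷ xs} u@(_ ∷ u′) xs⊆ys with ⊆-remove u xs⊆ys
... | _ , ys↭x∷ys′ , xs⊆ys′ =
  subst (suc (length xs) ≤_) (sym (↭-length ys↭x∷ys′)) (s≤s (Unique⇒length≤ u′ xs⊆ys′))

Unique⇒↭ : {xs ys : List A} → Unique xs → xs ⊆ ys → length ys ≤ length xs → xs ↭ ys
Unique⇒↭ {xs = []}     {[]}    _ _ _  = refl
Unique⇒↭ {xs = []}     {_ ∷ _} _ _ ()
Unique⇒↭ {xs = x ∷ xs} u@(_ ∷ u′) xs⊆ys ys≤xs with ⊆-remove u xs⊆ys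
... | ys′ , ys↭x∷ys′ , xs⊆ys′ =
  ↭-trans (prep x (Unique⇒↭ u′ xs⊆ys′ ys′≤xs)) (↭-sym ys↭x∷ys′)
  where
  ys′≤xs : length ys′ ≤ length xs
  ys′≤xs = ℕ.≤-pred (subst (_≤ suc (length xs)) (↭-length ys↭x∷ys′) ys≤xs)

Unique-map⁺ : {P : A → Set} {f : A → B} {xs : List A}
  → (∀ {x y} → P x → P y → f x ≡ f y → x ≡ y) → All P xs → Unique xs → Unique (map f xs)
Unique-map⁺ inj []         []         = []
Unique-map⁺ inj (px ∷ pxs) (x∉xs ∷ u) =
  AllProp.map⁺ (All.zipWith (λ (py , x≢y) → x≢y ∘ inj px py) (pxs , x∉xs)) ∷ Unique-map⁺ inj pxs u

toℕ-next : ∀ {k} (a : Fin (suc k)) → toℕ (next a) ≡ suc (toℕ a) ⊎ (toℕ a ≡ k × toℕ (next a) ≡ 0)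
toℕ-next {k} a with suc (toℕ a) <? suc k
... | yes a+1<N = inj₁ (toℕ-fromℕ< a+1<N)
... | no  a+1≮N = inj₂ (ℕ.≤-antisym (ℕ.≤-pred (toℕ<n a)) (ℕ.≮⇒≥ (a+1≮N ∘ s≤s)) , refl)

next-injective : ∀ {N} (a b : Fin N) → next a ≡ next b → a ≡ b
next-injective {suc k} a b na≡nb = toℕ-injective (cases (toℕ-next a) (toℕ-next b))
  where
  same : toℕ (next a) ≡ toℕ (next b)
  same = cong toℕ na≡nb
  cases : _ → _ → toℕ a ≡ toℕ b
  cases (inj₁ sa)       (inj₁ sb)       = ℕ.suc-injective (≡-trans (sym sa) (≡-trans same sb))
  cases (inj₁ sa)       (inj₂ (_ , zb)) with () ← ≡-trans (sym sa) (≡-trans same zb)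
  cases (inj₂ (_ , za)) (inj₁ sb)       with () ← ≡-trans (sym za) (≡-trans same sb)
  cases (inj₂ (la , _)) (inj₂ (lb , _)) = ≡-trans la (sym lb)

next∘next≢id : ∀ {N} → 3 ≤ N → (a : Fin N) → next (next a) ≢ a
next∘next≢id {suc k} (s≤s 1<k) a nna≡a = cases (toℕ-next a) (toℕ-next (next a))
  where
  back : toℕ (next (next a)) ≡ toℕ a
  back = cong toℕ nna≡a
  cases : _ → _ → ⊥
  cases (inj₁ sa)        (inj₁ ssa)         =
    ℕ.m≢1+n+m (toℕ a) {1} (≡-trans (sym back) (≡-trans ssa (cong suc sa)))
  cases (inj₁ sa)        (inj₂ (la′ , za′)) =
    ℕ.<⇒≢ 1<k (≡-trans (cong suc (≡-trans (sym za′) back)) (≡-trans (sym sa) la′))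
  cases (inj₂ (la , za)) (inj₁ ssa)         =
    ℕ.<⇒≢ 1<k (≡-trans (cong suc (sym za)) (≡-trans (sym ssa) (≡-trans back la)))
  cases (inj₂ (_ , za))  (inj₂ (la′ , za′)) =
    ℕ.<⇒≢ (ℕ.<-trans (s≤s z≤n) 1<k) (≡-trans (sym za) la′)

-- The hypercube

vertices : (m : ℕ) → List (Vertex m)
vertices zero    = []ᵥ ∷ []
vertices (suc m) = map (true ∷ᵥ_) (vertices m) ++ map (false ∷ᵥ_) (vertices m)

∈-vertices : ∀ {m} (v : Vertex m) → v ∈ vertices m
∈-vertices []ᵥ                   = here refl
∈-vertices (true ∷ᵥ v)           = ∈-++⁺ˡ (∈-map⁺ (true ∷ᵥ_) (∈-vertices v))
∈-vertices {suc m} (false ∷ᵥ v) =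
  ∈-++⁺ʳ (map (true ∷ᵥ_) (vertices m)) (∈-map⁺ (false ∷ᵥ_) (∈-vertices v))

length-vertices : (m : ℕ) → length (vertices m) ≡ 2 ^ m
length-vertices zero    = refl
length-vertices (suc m) = begin
  length (map (true ∷ᵥ_) (vertices m) ++ map (false ∷ᵥ_) (vertices m))
    ≡⟨ length-++ (map (true ∷ᵥ_) (vertices m)) ⟩
  length (map (true ∷ᵥ_) (vertices m)) + length (map (false ∷ᵥ_) (vertices m))
    ≡⟨ cong₂ _+_ (length-map _ (vertices m)) (length-map _ (vertices m)) ⟩
  length (vertices m) + length (vertices m)
    ≡⟨ cong₂ _+_ (length-vertices m) (≡-trans (length-vertices m) (sym (ℕ.+-identityʳ (2 ^ m)))) ⟩
  2 ^ suc m ∎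
  where open ≡-Reasoning

flip : ∀ {m} → Fin m → Vertex m → Vertex m
flip i v = updateAt v i not

module _ {m : ℕ} where

  lookup-ext : {u v : Vertex m} → (∀ k → lookup u k ≡ lookup v k) → u ≡ v
  lookup-ext {u} {v} u≗v = begin
    u                   ≡⟨ tabulate∘lookup u ⟨
    tabulate (lookup u) ≡⟨ tabulate-cong u≗v ⟩
    tabulate (lookup v) ≡⟨ tabulate∘lookup v ⟩
    v                   ∎
    where open ≡-Reasoning

  ≢-at : {u v : Vertex m} (k : Fin m) → lookup u k ≢ lookup v k → u ≢ v
  ≢-at k uₖ≢vₖ refl = uₖ≢vₖ refl

  flip-involutive : (i : Fin m) (v : Vertex m) → flip i (flip i v) ≡ v
  flip-involutive i v = ≡-trans (updateAt-updateAt i v)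
    (≡-trans (updateAt-cong i not-involutive v) (updateAt-id i v))

  flip-comm : {i j : Fin m} → i ≢ j → (v : Vertex m) → flip i (flip j v) ≡ flip j (flip i v)
  flip-comm {i} {j} i≢j = updateAt-commutes i j i≢j

  lookup-flip-≢ : (i : Fin m) (u w : Vertex m) → lookup u i ≢ lookup w i → lookup (flip i u) i ≡ lookup w i
  lookup-flip-≢ i u w uᵢ≢wᵢ = ≡-trans (lookup∘updateAt i u) (sym (¬-not (uᵢ≢wᵢ ∘ sym)))

  DimEdge-sym : {i : Fin m} {u v : Vertex m} → DimEdge i u v → DimEdge i v u
  DimEdge-sym (uᵢ≢vᵢ , agree) = uᵢ≢vᵢ ∘ sym , λ j j≢i → sym (agree j j≢i)

  DimEdge-flip : (i : Fin m) (v : Vertex m) → DimEdge i v (flip i v)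
  DimEdge-flip i v = (λ eq → not-¬ refl (≡-trans eq (lookup∘updateAt i v)))
                   , λ j j≢i → sym (lookup∘updateAt′ j i j≢i v)

  DimEdge⇒≡flip : {i : Fin m} {u v : Vertex m} → DimEdge i u v → v ≡ flip i u
  DimEdge⇒≡flip {i} {u} {v} (uᵢ≢vᵢ , agree) = lookup-ext λ k → at k (k ≟ i)
    where
    at : ∀ k → Dec (k ≡ i) → lookup v k ≡ lookup (flip i u) k
    at k (yes refl) = sym (lookup-flip-≢ i u v uᵢ≢vᵢ)
    at k (no k≢i)   = ≡-trans (sym (agree k k≢i)) (sym (lookup∘updateAt′ k i k≢i u))

  Adjacent-flip : (i : Fin m) (v : Vertex m) → Adjacent v (flip i v)
  Adjacent-flip i v = i , DimEdge-flip i v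

  Adjacent-flip⁻ : (i : Fin m) (v : Vertex m) → Adjacent (flip i v) v
  Adjacent-flip⁻ i v = i , DimEdge-sym {u = v} {flip i v} (DimEdge-flip i v)

  flip-square : {i j : Fin m} → i ≢ j → (v : Vertex m)
    → IsFourCycle v (flip i v) (flip j (flip i v)) (flip j v)
  flip-square {i} {j} i≢j v =
      ≢-at i (proj₁ (DimEdge-flip i v))
    , ≢-at i (λ eq → proj₁ (DimEdge-flip i v) (≡-trans eq (lookup∘updateAt′ i j i≢j (flip i v))))
    , ≢-at j (proj₁ (DimEdge-flip j v))
    , ≢-at j (proj₁ (DimEdge-flip j (flip i v)))
    , ≢-at i (λ eq → proj₁ (DimEdge-flip i v) (≡-trans (sym (lookup∘updateAt′ i j i≢j v)) (sym eq)))
    , ≢-at i (λ eq → proj₁ (DimEdge-flip i v) (≡-trans (sym (lookup∘updateAt′ i j i≢j v))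
                                                 (≡-trans (sym eq) (lookup∘updateAt′ i j i≢j (flip i v)))))
    , Adjacent-flip i v
    , Adjacent-flip j (flip i v)
    , subst (λ w → Adjacent w (flip j v)) (flip-comm i≢j v) (Adjacent-flip⁻ i (flip j v))
    , Adjacent-flip⁻ j v

  DimEdge-index : {i j : Fin m} (u v : Vertex m) → DimEdge j u v → lookup u i ≢ lookup v i → j ≡ i
  DimEdge-index {i} {j} u v (_ , agree) uᵢ≢vᵢ with j ≟ i
  ... | yes j≡i = j≡i
  ... | no  j≢i = ⊥-elim (uᵢ≢vᵢ (agree i (j≢i ∘ sym)))

  IsFourCycle-≡ : {v₀ v₁ v₂ v₃ w₁ w₂ w₃ : Vertex m} → w₁ ≡ v₁ → w₂ ≡ v₂ → w₃ ≡ v₃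
    → IsFourCycle v₀ v₁ v₂ v₃ → IsFourCycle v₀ w₁ w₂ w₃
  IsFourCycle-≡ refl refl refl square = square

  DimEdge? : (i : Fin m) (u v : Vertex m) → Dec (DimEdge i u v)
  DimEdge? i u v = ¬? (lookup u i Bool.≟ lookup v i)
                   ×-dec all? (λ j → ¬? (j ≟ i) →-dec lookup u j Bool.≟ lookup v j)

  Adjacent? : (u v : Vertex m) → Dec (Adjacent u v)
  Adjacent? u v = any? λ i → DimEdge? i u v

  IsFourCycle? : (v₀ v₁ v₂ v₃ : Vertex m) → Dec (IsFourCycle v₀ v₁ v₂ v₃)
  IsFourCycle? v₀ v₁ v₂ v₃ =
    v₀ ≢? v₁ ×-dec v₀ ≢? v₂ ×-dec v₀ ≢? v₃ ×-dec
    v₁ ≢? v₂ ×-dec v₁ ≢? v₃ ×-dec v₂ ≢? v₃ ×-dec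
    Adjacent? v₀ v₁ ×-dec Adjacent? v₁ v₂ ×-dec Adjacent? v₂ v₃ ×-dec Adjacent? v₃ v₀
    where
    _≢?_ : (u v : Vertex m) → Dec (u ≢ v)
    u ≢? v = ¬? (≡-dec Bool._≟_ u v)

parity-flip : ∀ {m} (i : Fin m) (v : Vertex m) → parity (flip i v) ≡ not (parity v)
parity-flip fzero    (x ∷ᵥ v) = sym (not-distribˡ-xor x (parity v))
parity-flip (fsuc i) (x ∷ᵥ v) = ≡-trans (cong (x xor_) (parity-flip i v)) (sym (not-distribʳ-xor x (parity v)))

flip-balanced : ∀ {m} (f : Vertex m → Bool) (j : Fin m) → (∀ v → f (flip j v) ≡ not (f v))
  → {vs : List (Vertex m)} → Unique vs → (∀ v → v ∈ vs)
  → countB f vs ≡ countB (not ∘ f) vs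
flip-balanced f j f∘flip≗not∘f {vs} unique complete = begin
  countB f vs                ≡⟨ countB-↭ f flip-permutes ⟨
  countB f (map (flip j) vs) ≡⟨ countB-map f (flip j) vs ⟩
  countB (f ∘ flip j) vs     ≡⟨ countB-cong f∘flip≗not∘f vs ⟩
  countB (not ∘ f) vs        ∎
  where
  open ≡-Reasoning
  flip-permutes : map (flip j) vs ↭ vs
  flip-permutes = Unique⇒↭ (UniqueProp.map⁺ flip-injective unique) (λ {v} _ → complete v)
                           (ℕ.≤-reflexive (sym (length-map (flip j) vs)))
    where
    flip-injective : ∀ {u v} → flip j u ≡ flip j v → u ≡ v
    flip-injective {u} {v} eq =
      ≡-trans (sym (flip-involutive j u)) (≡-trans (cong (flip j) eq) (flip-involutive j v))

-- Deleting a coordinate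

removeAt-flip : ∀ {m} (v : Vertex (suc m)) (i : Fin (suc m)) → removeAt (flip i v) i ≡ removeAt v i
removeAt-flip (x ∷ᵥ v)          fzero           = refl
removeAt-flip (x ∷ᵥ _ ∷ᵥ _)     (fsuc fzero)    = refl
removeAt-flip (x ∷ᵥ v@(_ ∷ᵥ _)) (fsuc (fsuc i)) = cong (x ∷ᵥ_) (removeAt-flip v (fsuc i))

parity-removeAt : ∀ {m} (v : Vertex (suc m)) (i : Fin (suc m)) → parity (removeAt v i) ≡ parity v xor lookup v i
parity-removeAt (x ∷ᵥ v)          fzero    = sym (begin
  (x xor parity v) xor x  ≡⟨ xor-comm (x xor parity v) x ⟩
  x xor (x xor parity v)  ≡⟨ xor-assoc x x (parity v) ⟨
  (x xor x) xor parity v  ≡⟨ cong (_xor parity v) (xor-same x) ⟩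
  parity v                ∎)
  where open ≡-Reasoning
parity-removeAt (x ∷ᵥ v@(_ ∷ᵥ _)) (fsuc i) =
  ≡-trans (cong (x xor_) (parity-removeAt v i)) (sym (xor-assoc x (parity v) (lookup v i)))

module _ {m : ℕ} (i : Fin (suc m)) where

  lookup-removeAt : (v : Vertex (suc m)) (k : Fin m) → lookup (removeAt v i) k ≡ lookup v (punchIn i k)
  lookup-removeAt v k = ≡-trans (cong (lookup (removeAt v i)) (sym (punchOut-punchIn i)))
                                (removeAt-punchOut v (punchInᵢ≢i i k ∘ sym))

  removeAt-lookup-injective : {u w : Vertex (suc m)}
    → removeAt u i ≡ removeAt w i → lookup u i ≡ lookup w i → u ≡ w
  removeAt-lookup-injective {u} {w} eq eqᵢ = begin
    u                                      ≡⟨ insertAt-removeAt u i ⟨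
    insertAt (removeAt u i) i (lookup u i) ≡⟨ cong₂ (λ x b → insertAt x i b) eq eqᵢ ⟩
    insertAt (removeAt w i) i (lookup w i) ≡⟨ insertAt-removeAt w i ⟩
    w                                      ∎
    where open ≡-Reasoning

  parity-removeAt-flip : {k : Fin (suc m)} → k ≢ i → (v : Vertex (suc m))
    → parity (removeAt (flip k v) i) ≡ not (parity (removeAt v i))
  parity-removeAt-flip {k} k≢i v = begin
    parity (removeAt (flip k v) i)
      ≡⟨ parity-removeAt (flip k v) i ⟩
    parity (flip k v) xor lookup (flip k v) i
      ≡⟨ cong₂ _xor_ (parity-flip k v) (lookup∘updateAt′ i k (k≢i ∘ sym) v) ⟩
    not (parity v) xor lookup v i
      ≡⟨ not-distribˡ-xor (parity v) (lookup v i) ⟨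
    not (parity v xor lookup v i)
      ≡⟨ cong not (parity-removeAt v i) ⟨
    not (parity (removeAt v i))
      ∎
    where open ≡-Reasoning

  removeAt-≡⇒ : {u w : Vertex (suc m)} → removeAt u i ≡ removeAt w i → w ≡ u ⊎ w ≡ flip i u
  removeAt-≡⇒ {u} {w} eq with lookup u i Bool.≟ lookup w i
  ... | yes uᵢ≡wᵢ = inj₁ (sym (removeAt-lookup-injective eq uᵢ≡wᵢ))
  ... | no  uᵢ≢wᵢ =
    inj₂ (sym (removeAt-lookup-injective (≡-trans (removeAt-flip u i) eq) (lookup-flip-≢ i u w uᵢ≢wᵢ)))

  DimEdge-removeAt⁻ : {k : Fin m} (u w : Vertex (suc m)) → DimEdge k (removeAt u i) (removeAt w i)
    → lookup u i ≡ lookup w i → DimEdge (punchIn i k) u w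
  DimEdge-removeAt⁻ {k} u w (uₖ≢wₖ , agree) uᵢ≡wᵢ = differ , agree′
    where
    differ : lookup u (punchIn i k) ≢ lookup w (punchIn i k)
    differ eq = uₖ≢wₖ (≡-trans (lookup-removeAt u k) (≡-trans eq (sym (lookup-removeAt w k))))
    agree′ : ∀ j → j ≢ punchIn i k → lookup u j ≡ lookup w j
    agree′ j j≢ with i ≟ j
    ... | yes refl = uᵢ≡wᵢ
    ... | no  i≢j  = begin
      lookup u j                            ≡⟨ removeAt-punchOut u i≢j ⟨
      lookup (removeAt u i) (punchOut i≢j)  ≡⟨ agree (punchOut i≢j) punchOut≢k ⟩
      lookup (removeAt w i) (punchOut i≢j)  ≡⟨ removeAt-punchOut w i≢j ⟩
      lookup w j                            ∎
      where
      open ≡-Reasoning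
      punchOut≢k : punchOut i≢j ≢ k
      punchOut≢k eq = j≢ (≡-trans (sym (punchIn-punchOut i≢j)) (cong (punchIn i) eq))

  DimEdge-removeAt⇒ : {k : Fin m} (u w : Vertex (suc m)) → DimEdge k (removeAt u i) (removeAt w i)
    → w ≡ flip (punchIn i k) u ⊎ w ≡ flip (punchIn i k) (flip i u)
  DimEdge-removeAt⇒ {k} u w edge with lookup u i Bool.≟ lookup w i
  ... | yes uᵢ≡wᵢ = inj₁ (DimEdge⇒≡flip (DimEdge-removeAt⁻ u w edge uᵢ≡wᵢ))
  ... | no  uᵢ≢wᵢ = inj₂ (DimEdge⇒≡flip (DimEdge-removeAt⁻ (flip i u) w edge′ flipᵢ≡wᵢ))
    where
    edge′ : DimEdge k (removeAt (flip i u) i) (removeAt w i)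
    edge′ = subst (λ x → DimEdge k x (removeAt w i)) (sym (removeAt-flip u i)) edge
    flipᵢ≡wᵢ : lookup (flip i u) i ≡ lookup w i
    flipᵢ≡wᵢ = lookup-flip-≢ i u w uᵢ≢wᵢ

-- The equi-independence number

¬¬-maximum : (P : ℕ → Set) (b : ℕ) {k : ℕ} → P k → (∀ j → P j → j ≤ b)
  → ¬ ¬ (∃ λ a → P a × (∀ j → P j → j ≤ a))
¬¬-maximum P zero    {k} pk ≤b ¬max = ¬max (k , pk , λ j pj → ℕ.≤-trans (≤b j pj) z≤n)
¬¬-maximum P (suc b)     pk ≤b ¬max = ¬¬-excluded-middle λ
  { (yes pb) → ¬max (suc b , pb , ≤b)
  ; (no ¬pb) → ¬¬-maximum P b pk (λ j pj → ℕ.≤-pred (ℕ.≤∧≢⇒< (≤b j pj) λ { refl → ¬pb pj }))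
                                ¬max }

¬¬-equiIndependenceNumber : (m : ℕ) → ¬ ¬ ∃ (IsEquiIndependenceNumber m)
¬¬-equiIndependenceNumber m ¬α =
  ¬¬-maximum HasEquiIndependentSetOfSize (length (vertices m)) empty ≤vertices
    λ (α , I , max) → ¬α (α , I , λ J J-equi → max (length J) (J , J-equi , refl))
  where
  HasEquiIndependentSetOfSize : ℕ → Set
  HasEquiIndependentSetOfSize k = Σ (List (Vertex m)) λ I → IsEquiIndependent I × length I ≡ k
  empty : HasEquiIndependentSetOfSize 0
  empty = [] , (([] , λ ()) , refl) , refl
  ≤vertices : ∀ k → HasEquiIndependentSetOfSize k → k ≤ length (vertices m)
  ≤vertices _ (I , ((I-unique , _) , _) , refl) = Unique⇒length≤ I-unique (λ {v} _ → ∈-vertices v)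

-- Shadows of the i-steps of a Hamiltonian cycle

module _ {m : ℕ} (H : HamiltonianCycle (suc (suc m))) (i : Fin (suc (suc m))) where

  private
    N : ℕ
    N = 2 ^ suc (suc m)
    h′ : Fin N → Vertex (suc (suc m))
    h′ = h H

  InscribedSquare : Set
  InscribedSquare = ∃₂ λ (a b : Fin N)
    → DimEdge i (h′ a) (h′ (next a)) × DimEdge i (h′ b) (h′ (next b))
    × (IsFourCycle (h′ a) (h′ (next a)) (h′ b) (h′ (next b))
       ⊎ IsFourCycle (h′ a) (h′ (next a)) (h′ (next b)) (h′ b))

  InscribedSquare? : Dec InscribedSquare
  InscribedSquare? = any? λ a → any? λ b →
    DimEdge? i (h′ a) (h′ (next a)) ×-dec DimEdge? i (h′ b) (h′ (next b))
    ×-dec (IsFourCycle? _ _ _ _ ⊎-dec IsFourCycle? _ _ _ _)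

  IStep : Fin N → Set
  IStep ι = lookup (h′ ι) i ≢ lookup (h′ (next ι)) i

  IStep? : Decidable IStep
  IStep? ι = ¬? (lookup (h′ ι) i Bool.≟ lookup (h′ (next ι)) i)

  IStep⇒DimEdge : ∀ {ι} → IStep ι → DimEdge i (h′ ι) (h′ (next ι))
  IStep⇒DimEdge {ι} step with adjacent H ι
  ... | k , edge =
    subst (λ k → DimEdge k (h′ ι) (h′ (next ι))) (DimEdge-index (h′ ι) (h′ (next ι)) edge step) edge

  IStep⇒≡flip : ∀ {ι} → IStep ι → h′ (next ι) ≡ flip i (h′ ι)
  IStep⇒≡flip step = DimEdge⇒≡flip (IStep⇒DimEdge step)

  shadow : Fin N → Vertex (suc m)
  shadow ι = removeAt (h′ ι) i

  iSteps : List (Fin N)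
  iSteps = filter IStep? (allFin N)

  shadows : List (Vertex (suc m))
  shadows = map shadow iSteps

  length-shadows : length shadows ≡ chromatic H i
  length-shadows = begin
    length shadows                             ≡⟨ length-map shadow iSteps ⟩
    length iSteps                              ≡⟨ length-filter IStep? (allFin N) ⟩
    countB (λ ι → does (IStep? ι)) (allFin N)
      ≡⟨ countB-cong (λ ι → cong not (isYes≗does (≟-at ι))) (allFin N) ⟨
    chromatic H i                              ∎
    where
    open ≡-Reasoning
    ≟-at : ∀ ι → Dec (lookup (h′ ι) i ≡ lookup (h′ (next ι)) i)
    ≟-at ι = lookup (h′ ι) i Bool.≟ lookup (h′ (next ι)) i

  shadows-unique : Unique shadows
  shadows-unique = Unique-map⁺ shadow-injective (AllProp.all-filter IStep? (allFin N))
                               (UniqueProp.filter⁺ IStep? (UniqueProp.allFin⁺ N))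
    where
    3≤N : 3 ≤ N
    3≤N = ℕ.≤-trans (ℕ.n≤1+n 3) (ℕ.^-monoʳ-≤ 2 {2} {suc (suc m)} (s≤s (s≤s z≤n)))
    shadow-injective : ∀ {x y} → IStep x → IStep y → shadow x ≡ shadow y → x ≡ y
    shadow-injective {x} {y} sx sy eq with removeAt-≡⇒ i eq
    ... | inj₁ hy≡hx   = distinct H x y (sym hy≡hx)
    ... | inj₂ hy≡flip = ⊥-elim (next∘next≢id 3≤N x (≡-trans (cong next nx≡y) ny≡x))
      where
      open ≡-Reasoning
      nx≡y : next x ≡ y
      nx≡y = distinct H _ _ (≡-trans (IStep⇒≡flip sx) (sym hy≡flip))
      ny≡x : next y ≡ x
      ny≡x = distinct H _ _ (begin
        h′ (next y)             ≡⟨ IStep⇒≡flip sy ⟩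
        flip i (h′ y)           ≡⟨ cong (flip i) hy≡flip ⟩
        flip i (flip i (h′ x))  ≡⟨ flip-involutive i (h′ x) ⟩
        h′ x                    ∎)

  inscribed-square : ∀ {a b k} → IStep a → IStep b → DimEdge k (shadow a) (shadow b)
    → IsFourCycle (h′ a) (h′ (next a)) (h′ b) (h′ (next b))
      ⊎ IsFourCycle (h′ a) (h′ (next a)) (h′ (next b)) (h′ b)
  inscribed-square {a} {b} {k} sa sb edge
    with punchIn i k | punchInᵢ≢i i k | DimEdge-removeAt⇒ i (h′ a) (h′ b) edge
  ... | j | j≢i | inj₁ hb≡ = inj₂ (IsFourCycle-≡ (IStep⇒≡flip sa) hnb≡ hb≡ (flip-square (j≢i ∘ sym) (h′ a)))
    where
    open ≡-Reasoning
    hnb≡ : h′ (next b) ≡ flip j (flip i (h′ a))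
    hnb≡ = begin
      h′ (next b)             ≡⟨ IStep⇒≡flip sb ⟩
      flip i (h′ b)           ≡⟨ cong (flip i) hb≡ ⟩
      flip i (flip j (h′ a))  ≡⟨ flip-comm (j≢i ∘ sym) (h′ a) ⟩
      flip j (flip i (h′ a))  ∎
  ... | j | j≢i | inj₂ hb≡ = inj₁ (IsFourCycle-≡ (IStep⇒≡flip sa) hb≡ hnb≡ (flip-square (j≢i ∘ sym) (h′ a)))
    where
    open ≡-Reasoning
    hnb≡ : h′ (next b) ≡ flip j (h′ a)
    hnb≡ = begin
      h′ (next b)                      ≡⟨ IStep⇒≡flip sb ⟩
      flip i (h′ b)                    ≡⟨ cong (flip i) hb≡ ⟩
      flip i (flip j (flip i (h′ a)))  ≡⟨ flip-comm (j≢i ∘ sym) (flip i (h′ a)) ⟩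
      flip j (flip i (flip i (h′ a)))  ≡⟨ cong (flip j) (flip-involutive i (h′ a)) ⟩
      flip j (h′ a)                    ∎

  shadows-independent : ¬ InscribedSquare → ∀ {u v} → u ∈ shadows → v ∈ shadows → ¬ Adjacent u v
  shadows-independent noSquare u∈ v∈ (k , edge) with ∈-map⁻ shadow u∈ | ∈-map⁻ shadow v∈
  ... | a , a∈ , refl | b , b∈ , refl =
    noSquare (a , b , IStep⇒DimEdge sa , IStep⇒DimEdge sb , inscribed-square sa sb edge)
    where
    sa : IStep a
    sa = proj₂ (∈-filter⁻ IStep? {xs = allFin N} a∈)
    sb : IStep b
    sb = proj₂ (∈-filter⁻ IStep? {xs = allFin N} b∈)

  parity-shadow-next : ∀ ι → parity (shadow (next ι)) ≡ parity (shadow ι) xor not (does (IStep? ι))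
  parity-shadow-next ι with lookup (h′ ι) i Bool.≟ lookup (h′ (next ι)) i | adjacent H ι
  ... | no step | _ = begin
    parity (removeAt (h′ (next ι)) i)   ≡⟨ cong (λ v → parity (removeAt v i)) (IStep⇒≡flip step) ⟩
    parity (removeAt (flip i (h′ ι)) i) ≡⟨ cong parity (removeAt-flip (h′ ι) i) ⟩
    parity (shadow ι)                   ≡⟨ xor-identityʳ _ ⟨
    parity (shadow ι) xor false         ∎
    where open ≡-Reasoning
  ... | yes same | k , edge = begin
    parity (removeAt (h′ (next ι)) i)
      ≡⟨ cong (λ v → parity (removeAt v i)) (DimEdge⇒≡flip {u = h′ ι} {h′ (next ι)} edge) ⟩
    parity (removeAt (flip k (h′ ι)) i) ≡⟨ parity-removeAt-flip i (λ { refl → proj₁ edge same }) (h′ ι) ⟩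
    not (parity (shadow ι))             ≡⟨ xor-comm (parity (shadow ι)) true ⟨
    parity (shadow ι) xor true          ∎
    where open ≡-Reasoning

  cycle-unique : Unique (map h′ (allFin N))
  cycle-unique = UniqueProp.map⁺ (distinct H _ _) (UniqueProp.allFin⁺ N)

  ∈-cycle : ∀ v → v ∈ map h′ (allFin N)
  ∈-cycle v = ∈-resp-↭ (↭-sym cycle↭vertices) (∈-vertices v)
    where
    cycle↭vertices : map h′ (allFin N) ↭ vertices (suc (suc m))
    cycle↭vertices = Unique⇒↭ cycle-unique (λ {v} _ → ∈-vertices v)
      (ℕ.≤-reflexive (≡-trans (length-vertices (suc (suc m)))
                              (sym (≡-trans (length-map h′ (allFin N)) (length-tabulate {n = N} id)))))

  parity-shadow-balanced : countB (parity ∘ shadow) (allFin N) ≡ countB (not ∘ parity ∘ shadow) (allFin N)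
  parity-shadow-balanced = begin
    countB (parity ∘ shadow) (allFin N)        ≡⟨ countB-map g h′ (allFin N) ⟨
    countB g (map h′ (allFin N))
      ≡⟨ flip-balanced g j (parity-removeAt-flip i j≢i) cycle-unique ∈-cycle ⟩
    countB (not ∘ g) (map h′ (allFin N))       ≡⟨ countB-map (not ∘ g) h′ (allFin N) ⟩
    countB (not ∘ parity ∘ shadow) (allFin N)  ∎
    where
    open ≡-Reasoning
    g : Vertex (suc (suc m)) → Bool
    g v = parity (removeAt v i)
    j : Fin (suc (suc m))
    j = punchIn i fzero
    j≢i : j ≢ i
    j≢i = punchInᵢ≢i i fzero

  shadows-balanced : countB (not ∘ parity) shadows ≡ countB parity shadows
  shadows-balanced = begin
    countB (not ∘ parity) shadows
      ≡⟨ count-in-class (not ∘ parity) ⟩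
    countB (λ ι → does (IStep? ι) ∧ not (parity (shadow ι))) (allFin N)
      ≡⟨ marked-balanced next next-permutes (does ∘ IStep?) (parity ∘ shadow)
                         parity-shadow-next parity-shadow-balanced ⟨
    countB (λ ι → does (IStep? ι) ∧ parity (shadow ι)) (allFin N)
      ≡⟨ count-in-class parity ⟨
    countB parity shadows
      ∎
    where
    open ≡-Reasoning
    count-in-class : (r : Vertex (suc m) → Bool)
      → countB r shadows ≡ countB (λ ι → does (IStep? ι) ∧ r (shadow ι)) (allFin N)
    count-in-class r = ≡-trans (countB-map r shadow iSteps) (countB-filter IStep? (r ∘ shadow) (allFin N))
    next-permutes : map next (allFin N) ↭ allFin N
    next-permutes = Unique⇒↭ (UniqueProp.map⁺ (next-injective _ _) (UniqueProp.allFin⁺ N))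
                             (λ {ι} _ → ∈-allFin ι) (ℕ.≤-reflexive (sym (length-map next (allFin N))))

  shadows-equiIndependent : ¬ InscribedSquare → IsEquiIndependent shadows
  shadows-equiIndependent noSquare = (shadows-unique , shadows-independent noSquare) , shadows-balanced

-- The inscribed square is decidable, so refuting its absence suffices; that refutation may
-- then use α_=(Q_{n-1}), which exists only up to double negation here.
corollary3 : (n : ℕ) → 2 ≤ n → (H : HamiltonianCycle n) → (i : Fin n)
    → (∀ (a : ℕ) → IsEquiIndependenceNumber (n ∸ 1) a → a < chromatic H i)
    → ∃₂ λ (a b : Fin _)
        → DimEdge i (h H a) (h H (next a))
        × DimEdge i (h H b) (h H (next b))
        × (IsFourCycle (h H a) (h H (next a)) (h H b) (h H (next b))
           ⊎ IsFourCycle (h H a) (h H (next a)) (h H (next b)) (h H b))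
corollary3 (suc zero)    (s≤s ())
corollary3 (suc (suc m)) _        H i c>α = decidable-stable (InscribedSquare? H i) λ noSquare →
  ¬¬-equiIndependenceNumber (suc m) λ (α , isα@(_ , maximal)) →
    ℕ.<⇒≱ (c>α α isα)
      (subst (_≤ α) (length-shadows H i) (maximal (shadows H i) (shadows-equiIndependent H i noSquare)))
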